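{- Every equinumerous $4$-coloring of $\mathbb{Z}_8$ contains a rainbow $AP(4)$; that is, for every map $c:\mathbb{Z}_8\to\{A,B,C,D\}$ in which each of the four colors is used exactly twice, there exist $x,d\in\mathbb{Z}_8$ such that $x,\,x+d,\,x+2d,\,x+3d$ are four distinct elements of $\mathbb{Z}_8$ receiving four pairwise distinct colors under $c$.
   Context: $\mathbb{Z}_8$ is the cyclic group of integers modulo $8$; arithmetic progressions are taken modulo $8$ (they may wrap around), and only progressions consisting of four distinct elements are considered. An equinumerous $4$-coloring of $\mathbb{Z}_8$ is one in which each color class has exactly $2$ elements. -}

module Defs where

open import Data.Nat using (ℕ; _+_; _*_)
open import Data.Nat.DivMod using (_mod_)
open import Data.Fin using (Fin; toℕ)
open import Data.Fin.Properties using (_≟_)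
open import Data.List using (length; filter; allFin)
open import Relation.Binary.PropositionalEquality using (_≡_)
open import Relation.Nullary using (¬_)
open import Data.Product using (_×_)

Z8 : Set
Z8 = Fin 8

_⊕_ : Z8 → Z8 → Z8
x ⊕ y = (toℕ x + toℕ y) mod 8

_·_ : ℕ → Z8 → Z8
k · d = (k * toℕ d) mod 8

Colour : Set
Colour = Fin 4

count : (Z8 → Colour) → Colour → ℕ
count c k = length (filter (λ x → c x ≟ k) (allFin 8))

Equinumerous : (Z8 → Colour) → Set
Equinumerous c = (k : Colour) → count c k ≡ 2

AllDistinct4 : {A : Set} → A → A → A → A → Set
AllDistinct4 a b c d =
  ¬ a ≡ b × ¬ a ≡ c × ¬ a ≡ d × ¬ b ≡ c × ¬ b ≡ d × ¬ c ≡ d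

RainbowAP4 : (Z8 → Colour) → Z8 → Z8 → Set
RainbowAP4 c x d =
  AllDistinct4 x (x ⊕ d) (x ⊕ (2 · d)) (x ⊕ (3 · d))
  × AllDistinct4 (c x) (c (x ⊕ d)) (c (x ⊕ (2 · d))) (c (x ⊕ (3 · d)))

module Submission where

-- ℤ₈ splits into the evens and the odds, each a 4-cycle under x ↦ x + 2, and a coset with four
-- colours is itself a rainbow AP with d = 2. Otherwise the evens repeat a colour A and the odds a
-- colour B; as colour classes have size two, A ≠ B and no other point is coloured A or B. In a
-- 4-cycle every vertex is adjacent to one of any two others, so every even point m outside the
-- A-pair shares an edge with an A-point, and every odd point p outside the B-pair one with a
-- B-point; of the two such p, one has a colour different from that of m. This yields an even edge
-- and an odd edge carrying four distinct colours, and any such pair of edges is traversed by an AP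
-- with odd difference, visiting the even edge at its 1st and 3rd terms and the odd one at its 2nd
-- and 4th.

open import Data.Fin using (Fin; #_; toℕ; combine)
open import Data.Fin.Patterns using (0F; 1F; 2F; 3F)
open import Data.Fin.Properties using (_≟_; all?; any?; combine-injective; injective⇒≤)
open import Data.List using (List; length; filter)
import Data.List as List
open import Data.List.Membership.Propositional using (_∈_)
open import Data.List.Membership.Propositional.Properties using (∈-filter⁺; ∈-allFin)
open import Data.List.Relation.Unary.Any using (index)
open import Data.List.Relation.Unary.Any.Properties using (lookup-index)
open import Data.Nat using (_+_; _≤_; s≤s)
open import Data.Nat.DivMod using (_mod_)
open import Data.Product using (∃; ∃₂; _×_; _,_; proj₁; proj₂)
open import Data.Sum using (_⊎_; inj₁; inj₂)
open import Data.Vec using (Vec)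
import Data.Vec as Vec
open import Data.Vec.Relation.Unary.All using (All; []; _∷_)
open import Data.Vec.Relation.Unary.All.Properties using (lookup⁺)
open import Data.Vec.Relation.Unary.AllPairs using ([]; _∷_)
open import Data.Vec.Relation.Unary.Unique.Propositional using (Unique)
open import Data.Vec.Relation.Unary.Unique.Propositional.Properties using (lookup-injective)
open import Function.Definitions using (Injective)
open import Level using (0ℓ)
open import Relation.Binary.Definitions using (DecidableEquality)
open import Relation.Binary.PropositionalEquality
  using (_≡_; _≢_; refl; sym; trans; cong; subst; ≢-sym; module ≡-Reasoning)
open import Relation.Nullary using (¬_; Dec; yes; no; ¬?)
open import Relation.Nullary.Decidable using (toWitness; _×-dec_; _⊎-dec_; _→-dec_)
open import Relation.Unary using (Pred; Decidable)

open import Defs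

module _ {A : Set} where

  AllDistinct4-swap₁₃ : ∀ {a b c d : A} → AllDistinct4 a b c d → AllDistinct4 c b a d
  AllDistinct4-swap₁₃ (a≢b , a≢c , a≢d , b≢c , b≢d , c≢d) =
    ≢-sym b≢c , ≢-sym a≢c , c≢d , ≢-sym a≢b , b≢d , a≢d

  AllDistinct4-swap₂₄ : ∀ {a b c d : A} → AllDistinct4 a b c d → AllDistinct4 a d c b
  AllDistinct4-swap₂₄ (a≢b , a≢c , a≢d , b≢c , b≢d , c≢d) =
    a≢d , a≢c , a≢b , ≢-sym c≢d , ≢-sym b≢d , ≢-sym b≢c

  AllDistinct4-swapPairs : ∀ {a b c d : A} → AllDistinct4 a b c d → AllDistinct4 c d a b
  AllDistinct4-swapPairs h = AllDistinct4-swap₁₃ (AllDistinct4-swap₂₄ h)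

  AllDistinct4-map⁻ : ∀ {B : Set} (f : A → B) {a b c d : A} →
    AllDistinct4 (f a) (f b) (f c) (f d) → AllDistinct4 a b c d
  AllDistinct4-map⁻ f (fa≢fb , fa≢fc , fa≢fd , fb≢fc , fb≢fd , fc≢fd) =
    (λ eq → fa≢fb (cong f eq)) , (λ eq → fa≢fc (cong f eq)) , (λ eq → fa≢fd (cong f eq)) ,
    (λ eq → fb≢fc (cong f eq)) , (λ eq → fb≢fd (cong f eq)) , (λ eq → fc≢fd (cong f eq))

  allDistinct4-or-collision : DecidableEquality A → (f : Fin 4 → A) →
    AllDistinct4 (f 0F) (f 1F) (f 2F) (f 3F) ⊎ ∃₂ λ i j → i ≢ j × f i ≡ f j
  allDistinct4-or-collision _≟ᴬ_ f
    with any? (λ i → any? λ j → ¬? (i ≟ j) ×-dec f i ≟ᴬ f j)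
  ... | yes collision = inj₂ collision
  ... | no ¬collision =
    inj₁ (distinct (λ ()) , distinct (λ ()) , distinct (λ ()) ,
          distinct (λ ()) , distinct (λ ()) , distinct (λ ()))
    where
    distinct : ∀ {i j} → i ≢ j → f i ≢ f j
    distinct {i} {j} i≢j fi≡fj = ¬collision (i , j , i≢j , fi≡fj)

module _ {A : Set} {P : Pred A 0ℓ} (P? : Decidable P) where

  unique-≤-length-filter : ∀ {m} {ys : Vec A m} {xs : List A} →
    Unique ys → All (_∈ xs) ys → All P ys → m ≤ length (filter P? xs)
  unique-≤-length-filter {ys = ys} {xs} ys-unique ys⊆xs Pys = injective⇒≤ position-injective
    where
    position : ∀ i → Vec.lookup ys i ∈ filter P? xs
    position i = ∈-filter⁺ P? (lookup⁺ ys⊆xs i) (lookup⁺ Pys i)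

    position-injective : Injective _≡_ _≡_ (λ i → index (position i))
    position-injective {i} {j} eq = lookup-injective ys-unique i j (begin
      Vec.lookup ys i                                 ≡⟨ lookup-index (position i) ⟩
      List.lookup (filter P? xs) (index (position i)) ≡⟨ cong (List.lookup (filter P? xs)) eq ⟩
      List.lookup (filter P? xs) (index (position j)) ≡⟨ sym (lookup-index (position j)) ⟩
      Vec.lookup ys j                                 ∎)
      where open ≡-Reasoning

-- pt i r = 2i + r, so translation by 2 moves pt i r to pt (next i) r.
pt : Fin 4 → Fin 2 → Z8
pt i r = combine {4} {2} i r

pt-≢ˡ : ∀ {i j r s} → i ≢ j → pt i r ≢ pt j s
pt-≢ˡ i≢j eq = i≢j (proj₁ (combine-injective _ _ _ _ eq))

even≢odd : ∀ i j → pt i 0F ≢ pt j 1F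
even≢odd i j eq with proj₂ (combine-injective i 0F j 1F eq)
... | ()

next : Fin 4 → Fin 4
next i = (1 + toℕ i) mod 4

Adjacent : Fin 4 → Fin 4 → Set
Adjacent u v = v ≡ next u ⊎ u ≡ next v

adjacent? : ∀ u v → Dec (Adjacent u v)
adjacent? u v = v ≟ next u ⊎-dec u ≟ next v

Outside : Fin 4 → Fin 4 → Fin 4 → Set
Outside i j m = m ≢ i × m ≢ j

outside? : ∀ i j m → Dec (Outside i j m)
outside? i j m = ¬? (m ≟ i) ×-dec ¬? (m ≟ j)

outside-adjacent : ∀ i j m → i ≢ j → Outside i j m → Adjacent m i ⊎ Adjacent m j
outside-adjacent = toWitness {a? = all? λ i → all? λ j → all? λ m →
  ¬? (i ≟ j) →-dec outside? i j m →-dec (adjacent? m i ⊎-dec adjacent? m j)} _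

two-outside : ∀ i j → i ≢ j → ∃₂ λ m m' → m ≢ m' × Outside i j m × Outside i j m'
two-outside = toWitness {a? = all? λ i → all? λ j → ¬? (i ≟ j) →-dec
  any? λ m → any? λ m' → ¬? (m ≟ m') ×-dec outside? i j m ×-dec outside? i j m'} _

rainbow-at : ∀ (c : Z8 → Colour) x d →
  AllDistinct4 (c x) (c (x ⊕ d)) (c (x ⊕ (2 · d))) (c (x ⊕ (3 · d))) →
  ∃₂ λ x d → RainbowAP4 c x d
rainbow-at c x d h = x , d , AllDistinct4-map⁻ c h , h

-- Take d = (2w + 1) − 2u and x = 2u if w − u is even, x = 2u + 2 if it is odd: then x, x + 2d
-- are the ends of the even edge and x + d, x + 3d those of the odd edge (both reversed when odd).
rainbow-of-edges : ∀ (c : Z8 → Colour) u w →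
  AllDistinct4 (c (pt u 0F)) (c (pt w 1F)) (c (pt (next u) 0F)) (c (pt (next w) 1F)) →
  ∃₂ λ x d → RainbowAP4 c x d
rainbow-of-edges c 0F 0F h = rainbow-at c (# 0) (# 1) h
rainbow-of-edges c 0F 1F h = rainbow-at c (# 2) (# 3) (AllDistinct4-swapPairs h)
rainbow-of-edges c 0F 2F h = rainbow-at c (# 0) (# 5) h
rainbow-of-edges c 0F 3F h = rainbow-at c (# 2) (# 7) (AllDistinct4-swapPairs h)
rainbow-of-edges c 1F 0F h = rainbow-at c (# 4) (# 7) (AllDistinct4-swapPairs h)
rainbow-of-edges c 1F 1F h = rainbow-at c (# 2) (# 1) h
rainbow-of-edges c 1F 2F h = rainbow-at c (# 4) (# 3) (AllDistinct4-swapPairs h)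
rainbow-of-edges c 1F 3F h = rainbow-at c (# 2) (# 5) h
rainbow-of-edges c 2F 0F h = rainbow-at c (# 4) (# 5) h
rainbow-of-edges c 2F 1F h = rainbow-at c (# 6) (# 7) (AllDistinct4-swapPairs h)
rainbow-of-edges c 2F 2F h = rainbow-at c (# 4) (# 1) h
rainbow-of-edges c 2F 3F h = rainbow-at c (# 6) (# 3) (AllDistinct4-swapPairs h)
rainbow-of-edges c 3F 0F h = rainbow-at c (# 0) (# 3) (AllDistinct4-swapPairs h)
rainbow-of-edges c 3F 1F h = rainbow-at c (# 6) (# 5) h
rainbow-of-edges c 3F 2F h = rainbow-at c (# 0) (# 7) (AllDistinct4-swapPairs h)
rainbow-of-edges c 3F 3F h = rainbow-at c (# 6) (# 1) h

rainbow-of-adjacent : ∀ (c : Z8 → Colour) {u u' w w'} → Adjacent u u' → Adjacent w w' →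
  AllDistinct4 (c (pt u 0F)) (c (pt w 1F)) (c (pt u' 0F)) (c (pt w' 1F)) →
  ∃₂ λ x d → RainbowAP4 c x d
rainbow-of-adjacent c {u} {w = w} (inj₁ refl) (inj₁ refl) h = rainbow-of-edges c u w h
rainbow-of-adjacent c {u} {w' = w'} (inj₁ refl) (inj₂ refl) h =
  rainbow-of-edges c u w' (AllDistinct4-swap₂₄ h)
rainbow-of-adjacent c {u' = u'} {w} (inj₂ refl) (inj₁ refl) h =
  rainbow-of-edges c u' w (AllDistinct4-swap₁₃ h)
rainbow-of-adjacent c {u' = u'} {w' = w'} (inj₂ refl) (inj₂ refl) h =
  rainbow-of-edges c u' w' (AllDistinct4-swapPairs h)

module _ {c : Z8 → Colour} (equinumerous : Equinumerous c) where

  colour-of-pair-excludes : ∀ {x y z w} → x ≢ y → c x ≡ c y → z ≢ x → z ≢ y →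
    c w ≡ c x → c z ≢ c w
  colour-of-pair-excludes {x} {y} {z} x≢y cx≡cy z≢x z≢y cw≡cx cz≡cw =
    3≰2 (subst (3 ≤_) (equinumerous (c x)) three≤count)
    where
    3≰2 : ¬ 3 ≤ 2
    3≰2 (s≤s (s≤s ()))

    three≤count : 3 ≤ count c (c x)
    three≤count = unique-≤-length-filter (λ v → c v ≟ c x)
      ((x≢y ∷ ≢-sym z≢x ∷ []) ∷ (≢-sym z≢y ∷ []) ∷ [] ∷ [])
      (∈-allFin x ∷ ∈-allFin y ∷ ∈-allFin z ∷ [])
      (refl ∷ sym cx≡cy ∷ trans cz≡cw cw≡cx ∷ [])

  neighbour-in-pair : ∀ {i j m r} → i ≢ j → Outside i j m → c (pt i r) ≡ c (pt j r) →
    ∃ λ a → Adjacent m a × c (pt a r) ≡ c (pt i r)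
  neighbour-in-pair {i} {j} {m} i≢j m∉ ci≡cj with outside-adjacent i j m i≢j m∉
  ... | inj₁ m~i = i , m~i , refl
  ... | inj₂ m~j = j , m~j , sym ci≡cj

  rainbow-of-outsiders : ∀ {i j k l m p} →
    i ≢ j → c (pt i 0F) ≡ c (pt j 0F) → k ≢ l → c (pt k 1F) ≡ c (pt l 1F) →
    Outside i j m → Outside k l p → c (pt m 0F) ≢ c (pt p 1F) →
    ∃₂ λ x d → RainbowAP4 c x d
  rainbow-of-outsiders {i} {j} {k} {l} {m} {p} i≢j ci≡cj k≢l ck≡cl (m≢i , m≢j) (p≢k , p≢l) m≢p
    with a , m~a , ca≡ci ← neighbour-in-pair i≢j (m≢i , m≢j) ci≡cj
       | b , p~b , cb≡ck ← neighbour-in-pair k≢l (p≢k , p≢l) ck≡cl =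
    rainbow-of-adjacent c m~a p~b
      ( m≢p
      , even-excluded (pt-≢ˡ m≢i) (pt-≢ˡ m≢j) ca≡ci
      , odd-excluded (even≢odd m k) (even≢odd m l) cb≡ck
      , even-excluded (≢-sym (even≢odd i p)) (≢-sym (even≢odd j p)) ca≡ci
      , odd-excluded (pt-≢ˡ p≢k) (pt-≢ˡ p≢l) cb≡ck
      , odd-excluded (even≢odd a k) (even≢odd a l) cb≡ck )
    where
    even-excluded : ∀ {z w} → z ≢ pt i 0F → z ≢ pt j 0F → c w ≡ c (pt i 0F) → c z ≢ c w
    even-excluded = colour-of-pair-excludes (pt-≢ˡ i≢j) ci≡cj

    odd-excluded : ∀ {z w} → z ≢ pt k 1F → z ≢ pt l 1F → c w ≡ c (pt k 1F) → c z ≢ c w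
    odd-excluded = colour-of-pair-excludes (pt-≢ˡ k≢l) ck≡cl

  rainbow-of-colour-pairs : ∀ {i j k l} → i ≢ j → c (pt i 0F) ≡ c (pt j 0F) →
    k ≢ l → c (pt k 1F) ≡ c (pt l 1F) → ∃₂ λ x d → RainbowAP4 c x d
  rainbow-of-colour-pairs {i} {j} {k} {l} i≢j ci≡cj k≢l ck≡cl
    with m , _ , _ , m∉ , _ ← two-outside i j i≢j
       | p , p' , p≢p' , p∉ , p'∉ ← two-outside k l k≢l
    with c (pt m 0F) ≟ c (pt p 1F)
  ... | no cm≢cp = rainbow-of-outsiders i≢j ci≡cj k≢l ck≡cl m∉ p∉ cm≢cp
  ... | yes cm≡cp = rainbow-of-outsiders i≢j ci≡cj k≢l ck≡cl m∉ p'∉ cm≢cp'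
    where
    cm≢cp' : c (pt m 0F) ≢ c (pt p' 1F)
    cm≢cp' = ≢-sym (colour-of-pair-excludes (even≢odd m p) cm≡cp
                     (≢-sym (even≢odd m p')) (pt-≢ˡ (≢-sym p≢p')) refl)

mainTheorem3 : (c : Z8 → Colour) → Equinumerous c →
    ∃₂ λ (x d : Z8) → RainbowAP4 c x d
mainTheorem3 c equinumerous
  with allDistinct4-or-collision _≟_ (λ i → c (pt i 0F))
     | allDistinct4-or-collision _≟_ (λ i → c (pt i 1F))
... | inj₁ evens-distinct | _ = rainbow-at c (# 0) (# 2) evens-distinct
... | inj₂ _ | inj₁ odds-distinct = rainbow-at c (# 1) (# 2) odds-distinct
... | inj₂ (i , j , i≢j , ci≡cj) | inj₂ (k , l , k≢l , ck≡cl) =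
  rainbow-of-colour-pairs equinumerous i≢j ci≡cj k≢l ck≡cl
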